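{- Let $n=p_1p_2\cdots p_r$, where $p_1,\ldots,p_r$ are distinct prime numbers, and let $a,b$ be two distinct proper divisors of $n$ such that $\frac{a}{b}=\frac{p_k}{p_l}$ for some $k,l\in\{1,2,\ldots,r\}$. If $a<b$, then $\deg(a)>\deg(b)$ in $\mathcal{P}(C_n)$.
   Context: For a finite group $G$, the power graph $\mathcal{P}(G)$ is the simple undirected graph with vertex set $G$ in which two distinct vertices are adjacent if one of them is an integral power of the other. $C_n$ denotes the cyclic group of order $n$, identified with $\mathbb{Z}_n=\{0,1,\ldots,n-1\}$; a positive divisor $d$ of $n$ is regarded as the vertex $d \bmod n$. A proper divisor of $n$ is a positive divisor $a$ of $n$ with $a\notin\{1,n\}$. $\deg(a)$ denotes the degree of vertex $a$ in $\mathcal{P}(C_n)$. -}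

module Defs where

open import Data.Nat using (ℕ; zero; suc; _*_; _%_)
open import Data.Nat.Properties using (_≟_)
open import Data.Fin using (Fin; toℕ)
open import Data.Fin.Properties using (any?)
open import Data.List using (List; length; filter; allFin)
open import Data.Product using (Σ; _×_; _,_)
open import Data.Sum using (_⊎_)
open import Relation.Nullary using (¬_; Dec; yes; no)
open import Relation.Nullary.Decidable using (_×-dec_; _⊎-dec_; ¬?)
open import Relation.Binary.PropositionalEquality using (_≡_; _≢_)

-- reduction modulo n (only used for n ≥ 1; value at n = 0 irrelevant)
modN : ℕ → ℕ → ℕ
modN m zero    = m
modN m (suc n) = m % suc n

-- C_n ≅ ℤ_n = {0,…,n-1} written additively: the k-th power of y is k·y mod n.
-- Since y has finite order dividing n, integral powers are exactly k·y for k ∈ {0,…,n-1}.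
IsPowerOf : (n x y : ℕ) → Set
IsPowerOf n x y = Σ (Fin n) λ k → modN (toℕ k * y) n ≡ x

isPowerOf? : (n x y : ℕ) → Dec (IsPowerOf n x y)
isPowerOf? n x y = any? (λ k → modN (toℕ k * y) n ≟ x)

Adj : (n x y : ℕ) → Set
Adj n x y = (x ≢ y) × (IsPowerOf n x y ⊎ IsPowerOf n y x)

adj? : (n x y : ℕ) → Dec (Adj n x y)
adj? n x y = ¬? (x ≟ y) ×-dec (isPowerOf? n x y ⊎-dec isPowerOf? n y x)

deg : (n a : ℕ) → ℕ
deg n a = length (filter (λ (v : Fin n) → adj? n a (toℕ v)) (allFin n))

-- For a divisor x of a squarefree n with cofactor r (n = r·x, so x is a unit
-- modulo r), the neighbours of x in 𝒫(C_n) are the multiples of x (the powers of x) and the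
-- units modulo r (exactly the elements of which x is a power).  Counting over ℤ_n gives the
--     degree formula:  deg x + 1 + φ r = r + x·φ r.
-- From a·p_l = b·p_k and squarefreeness, a = m·p, b = m·q and n = s·p·(m·q) with p < q prime,
-- so the cofactors of a and b are q·s and p·s.  Since φ (p·s) = (p - 1)·φ s, the two degree
-- formulas give deg a - deg b = (q - p)·(s + (m - 1)·φ s) > 0.
module Submission where

open import Defs
open import Data.Nat
  using ( ℕ; zero; suc; _+_; _*_; _≤_; _<_; z≤n; s≤s; s≤s⁻¹; _%_; _/_
        ; NonZero; ≢-nonZero; >-nonZero; >-nonZero⁻¹; ≢-nonZero⁻¹; nonTrivial⇒n>1)
open import Data.Nat.Properties
open import Data.Nat.Divisibility
open import Data.Nat.Tactic.RingSolver using (solve-∀)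
open import Data.Nat.DivMod
  using (m≡m%n+[m/n]*n; [m+kn]%n≡m%n; m<n⇒m%n≡m; %-distribˡ-*; m%n%n≡m%n; m%n<n; m%n*o≡m*o%[n*o])
open import Data.Nat.GCD using (module Bézout)
open import Data.Nat.Coprimality using (Coprime; coprime?; coprime-+; coprime-divisor; coprime-Bézout)
import Data.Nat.Coprimality as Coprime
open import Data.Nat.Primality
  using ( Prime; euclidsLemma; prime⇒irreducible; prime⇒nonZero; prime⇒nonTrivial; ¬prime[1]
        ; productOfPrimes≢0)
open import Data.Nat.Primality.Factorisation
  using (PrimeFactorisation; factorise; factorisationHasAllPrimeFactors)
open import Data.Nat.ListAction using (product)
open import Data.List.Relation.Unary.All using (All; _∷_; [])
import Data.List.Relation.Unary.All as All
open import Data.List.Relation.Unary.AllPairs using (_∷_; [])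
open import Data.List.Relation.Unary.Unique.Propositional using (Unique)
open import Data.List.Membership.Propositional using (_∈_)
open import Data.Product using (Σ; _×_; _,_; proj₁; proj₂; swap)
open import Data.Sum using (_⊎_; inj₁; inj₂)
import Data.Sum as Sum
open import Data.Fin using (Fin; toℕ; fromℕ<)
import Data.Fin as Fin
open import Data.List using (List; _∷_; []; length; filter; tabulate)
open import Data.Fin.Properties using (toℕ-fromℕ<)
open import Data.Unit using (tt)
open import Function using (id; _∘_; case_of_; _⇔_; mk⇔; Equivalence)
open import Relation.Nullary using (¬_; Dec; yes; no; contradiction)
open import Relation.Nullary.Decidable using (_×-dec_; _⊎-dec_; ¬?)
open import Relation.Unary using (Decidable)
open import Relation.Binary.PropositionalEquality
import Function.Properties.Equivalence as ⇔

open Equivalence using (to; from)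

indicator : {A : Set} → Dec A → ℕ
indicator (yes _) = 1
indicator (no _)  = 0

indicator-cong : {A B : Set} (A? : Dec A) (B? : Dec B) → A ⇔ B → indicator A? ≡ indicator B?
indicator-cong (yes _) (yes _) A⇔B = refl
indicator-cong (yes a) (no ¬b) A⇔B = contradiction (to A⇔B a) ¬b
indicator-cong (no ¬a) (yes b) A⇔B = contradiction (from A⇔B b) ¬a
indicator-cong (no _)  (no _)  A⇔B = refl

indicator-split : {A B : Set} (A? : Dec A) (B? : Dec B) →
  indicator A? ≡ indicator (A? ×-dec B?) + indicator (A? ×-dec ¬? B?)
indicator-split (yes _) (yes _) = refl
indicator-split (yes _) (no _)  = refl
indicator-split (no _)  (yes _) = refl
indicator-split (no _)  (no _)  = refl

count : {P : ℕ → Set} → Decidable P → ℕ → ℕ → ℕ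
count P? k zero    = 0
count P? k (suc N) = indicator (P? k) + count P? (suc k) N

OnRange : (ℕ → Set) → ℕ → ℕ → Set
OnRange R k N = ∀ y → k ≤ y → y < k + N → R y

range-head : ∀ {R k N} → OnRange R k (suc N) → R k
range-head {k = k} {N} R-on = R-on k ≤-refl (subst (k <_) (sym (+-suc k N)) (s≤s (m≤m+n k N)))

range-tail : ∀ {R k N} → OnRange R k (suc N) → OnRange R (suc k) N
range-tail {k = k} {N} R-on y k<y y<end = R-on y (<⇒≤ k<y) (subst (y <_) (sym (+-suc k N)) y<end)

count-cong : ∀ {P Q : ℕ → Set} (P? : Decidable P) (Q? : Decidable Q) k N →
  OnRange (λ y → P y ⇔ Q y) k N → count P? k N ≡ count Q? k N
count-cong P? Q? k zero    P⇔Q = refl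
count-cong P? Q? k (suc N) P⇔Q =
  cong₂ _+_ (indicator-cong (P? k) (Q? k) (range-head P⇔Q)) (count-cong P? Q? (suc k) N (range-tail P⇔Q))

count-none : ∀ {P : ℕ → Set} (P? : Decidable P) k N → OnRange (λ y → ¬ P y) k N → count P? k N ≡ 0
count-none P? k zero    ¬P = refl
count-none P? k (suc N) ¬P with P? k
... | yes p = contradiction p (range-head ¬P)
... | no  _ = count-none P? (suc k) N (range-tail ¬P)

count-point : ∀ a k N → k ≤ a → a < k + N → count (a ≟_) k N ≡ 1
count-point a k zero    k≤a a<k+0 = contradiction (≤-trans a<k+0 (≤-reflexive (+-identityʳ k))) (≤⇒≯ k≤a)
count-point a k (suc N) k≤a a<end with a ≟ k
... | yes refl = cong suc (count-none (a ≟_) (suc a) N (λ y a<y _ a≡y → <-irrefl a≡y a<y))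
... | no  a≢k  = count-point a (suc k) N (≤∧≢⇒< k≤a (a≢k ∘ sym)) (subst (a <_) (+-suc k N) a<end)

count-all : ∀ k N → count (λ (_ : ℕ) → yes tt) k N ≡ N
count-all k zero    = refl
count-all k (suc N) = cong suc (count-all (suc k) N)

count-++ : ∀ {P : ℕ → Set} (P? : Decidable P) k N M →
  count P? k (N + M) ≡ count P? k N + count P? (k + N) M
count-++ P? k zero    M rewrite +-identityʳ k = refl
count-++ P? k (suc N) M rewrite count-++ P? (suc k) N M | +-suc k N =
  sym (+-assoc (indicator (P? k)) (count P? (suc k) N) _)

Periodic : (ℕ → Set) → ℕ → Set
Periodic P M = ∀ y → P y ⇔ P (y + M)

count-period-start : ∀ {P : ℕ → Set} (P? : Decidable P) M → Periodic P M →
  ∀ k → count P? k M ≡ count P? 0 M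
count-period-start P? M per zero    = refl
count-period-start P? M per (suc k) = trans shift (count-period-start P? M per k)
  where
  open ≡-Reasoning
  -- [k, k + 1 + M) is both {k} ∪ [k + 1, k + 1 + M) and [k, k + M) ∪ {k + M}, and [k] = [k + M].
  shift : count P? (suc k) M ≡ count P? k M
  shift = +-cancelˡ-≡ (indicator (P? k)) _ _ (begin
    indicator (P? k) + count P? (suc k) M        ≡⟨ cong (count P? k) (+-comm 1 M) ⟩
    count P? k (M + 1)                           ≡⟨ count-++ P? k M 1 ⟩
    count P? k M + (indicator (P? (k + M)) + 0)  ≡⟨ cong (count P? k M +_) (+-identityʳ _) ⟩
    count P? k M + indicator (P? (k + M))
      ≡⟨ cong (count P? k M +_) (indicator-cong (P? (k + M)) (P? k) (⇔.sym (per k))) ⟩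
    count P? k M + indicator (P? k)              ≡⟨ +-comm _ (indicator (P? k)) ⟩
    indicator (P? k) + count P? k M              ∎)

count-periodic : ∀ {P : ℕ → Set} (P? : Decidable P) M → Periodic P M →
  ∀ q k → count P? k (q * M) ≡ q * count P? 0 M
count-periodic P? M per zero    k = refl
count-periodic P? M per (suc q) k = trans (count-++ P? k M (q * M))
  (cong₂ _+_ (count-period-start P? M per k) (count-periodic P? M per q (k + M)))

count-split : ∀ {P Q : ℕ → Set} (P? : Decidable P) (Q? : Decidable Q) k N →
  count P? k N ≡ count (λ y → P? y ×-dec Q? y) k N + count (λ y → P? y ×-dec ¬? (Q? y)) k N
count-split P? Q? k zero    = refl
count-split P? Q? k (suc N) =
  trans (cong₂ _+_ (indicator-split (P? k) (Q? k)) (count-split P? Q? (suc k) N))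
        (interchange (indicator (P? k ×-dec Q? k)) (indicator (P? k ×-dec ¬? (Q? k)))
                     (count (λ y → P? y ×-dec Q? y) (suc k) N) (count (λ y → P? y ×-dec ¬? (Q? y)) (suc k) N))
  where
  interchange : ∀ a b c d → (a + b) + (c + d) ≡ (a + c) + (b + d)
  interchange = solve-∀

no-multiple-between : ∀ d j y → j * d < y → y < suc j * d → ¬ d ∣ y
no-multiple-between d j y jd<y y<[1+j]d (divides q refl) =
  <-irrefl refl (<-≤-trans (*-cancelʳ-< d j q jd<y) (s≤s⁻¹ (*-cancelʳ-< d q (suc j) y<[1+j]d)))

count-multiples : ∀ {Q : ℕ → Set} (Q? : Decidable Q) d .{{_ : NonZero d}} q j →
  count (λ y → (d ∣? y) ×-dec Q? y) (j * d) (q * d) ≡ count (λ w → Q? (w * d)) j q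
count-multiples Q? d@(suc d') zero    j = refl
count-multiples {Q} Q? d@(suc d') (suc q) j =
  trans (count-++ D? (j * d) d (q * d)) (cong₂ _+_ block rest)
  where
  D? : Decidable (λ y → d ∣ y × Q y)
  D? y = (d ∣? y) ×-dec Q? y
  block-end : suc (j * d) + d' ≡ suc j * d
  block-end = trans (sym (+-suc (j * d) d')) (+-comm (j * d) d)
  -- The block [j·d, (j + 1)·d) contains the single multiple j·d.
  block : count D? (j * d) d ≡ indicator (Q? (j * d))
  block = trans
    (cong₂ _+_ (indicator-cong (D? (j * d)) (Q? (j * d)) (mk⇔ proj₂ (n∣m*n j ,_)))
               (count-none D? (suc (j * d)) d' λ y jd<y y<end (d∣y , _) →
                  no-multiple-between d j y jd<y (subst (y <_) block-end y<end) d∣y))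
    (+-identityʳ _)
  rest : count D? (j * d + d) (q * d) ≡ count (λ w → Q? (w * d)) (suc j) q
  rest = trans (cong (λ z → count D? z (q * d)) (+-comm (j * d) d)) (count-multiples Q? d q (suc j))

φ : ℕ → ℕ
φ r = count (λ y → coprime? y r) 0 r

prime≢1 : ∀ {p} → Prime p → p ≢ 1
prime≢1 p-prime refl = ¬prime[1] p-prime

coprime-periodic : ∀ r → Periodic (λ y → Coprime y r) r
coprime-periodic r y = mk⇔ {A = Coprime y r} {B = Coprime (y + r) r}
  (λ y⊥r → subst (λ z → Coprime z r) (+-comm r y) (coprime-+ y⊥r))
  (λ y+r⊥r {e} (e∣y , e∣r) → y+r⊥r (∣m∣n⇒∣m+n e∣y e∣r , e∣r))

coprime-of-divisor : ∀ {x r d} → Coprime x r → d ∣ r → Coprime d x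
coprime-of-divisor x⊥r d∣r {e} (e∣d , e∣x) = x⊥r (e∣x , ∣-trans e∣d d∣r)

coprime-*-unit : ∀ {x r w} → Coprime x r → Coprime (w * x) r ⇔ Coprime w r
coprime-*-unit {x} {r} {w} x⊥r = mk⇔
  (λ wx⊥r {e} (e∣w , e∣r) → wx⊥r (∣m⇒∣m*n x e∣w , e∣r))
  (λ w⊥r {e} (e∣wx , e∣r) →
    w⊥r (coprime-divisor (coprime-of-divisor x⊥r e∣r) (subst (e ∣_) (*-comm w x) e∣wx) , e∣r))

coprime-prime-* : ∀ {p s y} → Prime p → Coprime y (p * s) ⇔ (Coprime y s × ¬ p ∣ y)
coprime-prime-* {p} {s} {y} p-prime = mk⇔
  (λ y⊥ps → (λ {e} (e∣y , e∣s) → y⊥ps (e∣y , ∣n⇒∣m*n p e∣s))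
          , (λ p∣y → prime≢1 p-prime (y⊥ps (p∣y , m∣m*n s))))
  (λ (y⊥s , p∤y) {e} (e∣y , e∣ps) →
    case prime⇒irreducible p-prime (coprime-divisor (coprime-of-divisor (Coprime.sym y⊥s) e∣y)
                                                    (subst (e ∣_) (*-comm p s) e∣ps)) of λ
      { (inj₁ e≡1)  → e≡1
      ; (inj₂ refl) → contradiction e∣y p∤y })

count-coprime-multiples : ∀ x r .{{_ : NonZero x}} → Coprime x r →
  count (λ y → coprime? y r ×-dec (x ∣? y)) 0 (x * r) ≡ φ r
count-coprime-multiples x r x⊥r = begin
  count (λ y → coprime? y r ×-dec (x ∣? y)) 0 (x * r)
    ≡⟨ count-cong _ _ 0 (x * r) (λ y _ _ → mk⇔ swap swap) ⟩
  count (λ y → (x ∣? y) ×-dec coprime? y r) 0 (x * r)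
    ≡⟨ cong (count (λ y → (x ∣? y) ×-dec coprime? y r) 0) (*-comm x r) ⟩
  count (λ y → (x ∣? y) ×-dec coprime? y r) (0 * x) (r * x)
    ≡⟨ count-multiples (λ y → coprime? y r) x r 0 ⟩
  count (λ w → coprime? (w * x) r) 0 r
    ≡⟨ count-cong _ _ 0 r (λ w _ _ → coprime-*-unit x⊥r) ⟩
  φ r ∎
  where open ≡-Reasoning

φ-prime-* : ∀ p s → Prime p → Coprime p s → φ (p * s) + φ s ≡ p * φ s
φ-prime-* p s p-prime p⊥s = begin
  φ (p * s) + φ s
    ≡⟨ +-comm (φ (p * s)) (φ s) ⟩
  φ s + φ (p * s)
    ≡⟨ cong₂ _+_ (sym (count-coprime-multiples p s p⊥s))
                 (count-cong _ _ 0 (p * s) λ y _ _ → coprime-prime-* p-prime) ⟩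
  count (λ y → C? y ×-dec (p ∣? y)) 0 (p * s) + count (λ y → C? y ×-dec ¬? (p ∣? y)) 0 (p * s)
    ≡⟨ count-split C? (p ∣?_) 0 (p * s) ⟨
  count C? 0 (p * s)
    ≡⟨ count-periodic C? s (coprime-periodic s) p 0 ⟩
  p * φ s ∎
  where
  open ≡-Reasoning
  instance
    p≢0 : NonZero p
    p≢0 = prime⇒nonZero p-prime
  C? : Decidable (λ y → Coprime y s)
  C? y = coprime? y s

φ-prime-*-difference : ∀ p d s → Prime p → Prime (p + d) → Coprime p s → Coprime (p + d) s →
  φ ((p + d) * s) ≡ φ (p * s) + d * φ s
φ-prime-*-difference p d s p-prime q-prime p⊥s q⊥s = +-cancelʳ-≡ (φ s) _ _ (begin
  φ ((p + d) * s) + φ s          ≡⟨ φ-prime-* (p + d) s q-prime q⊥s ⟩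
  (p + d) * φ s                  ≡⟨ *-distribʳ-+ (φ s) p d ⟩
  p * φ s + d * φ s              ≡⟨ cong (_+ d * φ s) (φ-prime-* p s p-prime p⊥s) ⟨
  φ (p * s) + φ s + d * φ s      ≡⟨ +-assoc (φ (p * s)) (φ s) (d * φ s) ⟩
  φ (p * s) + (φ s + d * φ s)    ≡⟨ cong (φ (p * s) +_) (+-comm (φ s) (d * φ s)) ⟩
  φ (p * s) + (d * φ s + φ s)    ≡⟨ +-assoc (φ (p * s)) (d * φ s) (φ s) ⟨
  φ (p * s) + d * φ s + φ s      ∎)
  where open ≡-Reasoning

modN≡% : ∀ m n .{{_ : NonZero n}} → modN m n ≡ m % n
modN≡% m (suc n) = refl

%-*-absorbˡ : ∀ m o n .{{_ : NonZero n}} → ((m % n) * o) % n ≡ (m * o) % n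
%-*-absorbˡ m o n = begin
  ((m % n) * o) % n              ≡⟨ %-distribˡ-* (m % n) o n ⟩
  ((m % n % n) * (o % n)) % n    ≡⟨ cong (λ z → (z * (o % n)) % n) (m%n%n≡m%n m n) ⟩
  ((m % n) * (o % n)) % n        ≡⟨ %-distribˡ-* m o n ⟨
  (m * o) % n                    ∎
  where open ≡-Reasoning

bezout-inverse : ∀ y r .{{_ : NonZero r}} → Bézout.Identity 1 y r → Σ ℕ λ k → (k * y) % r ≡ 1 % r
bezout-inverse y r (Bézout.+- k t 1+tr≡ky) = k , trans (cong (_% r) (sym 1+tr≡ky)) ([m+kn]%n≡m%n 1 t r)
bezout-inverse y r@(suc r') (Bézout.-+ k t 1+ky≡tr) = r' * k , (begin
  (r' * k * y) % r                ≡⟨ [m+kn]%n≡m%n (r' * k * y) 1 r ⟨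
  (r' * k * y + 1 * r) % r        ≡⟨ cong (_% r) (regroup r' k y) ⟩
  (1 + r' * (1 + k * y)) % r      ≡⟨ cong (λ z → (1 + r' * z) % r) 1+ky≡tr ⟩
  (1 + r' * (t * r)) % r          ≡⟨ cong (λ z → (1 + z) % r) (*-assoc r' t r) ⟨
  (1 + r' * t * r) % r            ≡⟨ [m+kn]%n≡m%n 1 (r' * t) r ⟩
  1 % r                           ∎)
  where
  open ≡-Reasoning
  regroup : ∀ r' k y → r' * k * y + 1 * suc r' ≡ 1 + r' * (1 + k * y)
  regroup = solve-∀

inverse-mod : ∀ y r .{{_ : NonZero r}} → Coprime y r → Σ ℕ λ k → k < r × (k * y) % r ≡ 1 % r
inverse-mod y r y⊥r with k , ky≡1 ← bezout-inverse y r (coprime-Bézout y⊥r) =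
  k % r , m%n<n k r , trans (%-*-absorbˡ k y r) ky≡1

power-of-divisor : ∀ n x y .{{_ : NonZero n}} .{{_ : NonZero x}} → x ∣ n → y < n →
  IsPowerOf n y x ⇔ x ∣ y
power-of-divisor n x y x∣n y<n = mk⇔ multiple power
  where
  multiple : IsPowerOf n y x → x ∣ y
  multiple (j , jx≡y) = ∣m+n∣m⇒∣n (subst (x ∣_) division (n∣m*n (toℕ j))) (∣-trans x∣n (n∣m*n q))
    where
    q : ℕ
    q = toℕ j * x / n
    division : toℕ j * x ≡ q * n + y
    division = begin
      toℕ j * x                 ≡⟨ m≡m%n+[m/n]*n (toℕ j * x) n ⟩
      (toℕ j * x) % n + q * n   ≡⟨ cong (_+ q * n) (trans (sym (modN≡% _ n)) jx≡y) ⟩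
      y + q * n                 ≡⟨ +-comm y (q * n) ⟩
      q * n + y                 ∎
      where open ≡-Reasoning
  power : x ∣ y → IsPowerOf n y x
  power (divides w refl) = fromℕ< w<n , (begin
    modN (toℕ (fromℕ< w<n) * x) n   ≡⟨ cong (λ z → modN (z * x) n) (toℕ-fromℕ< w<n) ⟩
    modN (w * x) n                  ≡⟨ modN≡% (w * x) n ⟩
    (w * x) % n                     ≡⟨ m<n⇒m%n≡m y<n ⟩
    w * x                           ∎)
    where
    open ≡-Reasoning
    w<n : w < n
    w<n = ≤-<-trans (m≤m*n w x) y<n

power-of-cofactor-unit : ∀ x r y .{{_ : NonZero (r * x)}} → Coprime x r → x < r * x →
  IsPowerOf (r * x) x y ⇔ Coprime y r
power-of-cofactor-unit x r y x⊥r x<n = mk⇔ unit power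
  where
  n : ℕ
  n = r * x
  instance
    r≢0 : NonZero r
    r≢0 = m*n≢0⇒m≢0 r
  unit : IsPowerOf n x y → Coprime y r
  unit (j , jy≡x) {e} (e∣y , e∣r) =
    ∣1⇒≡1 (∣m+n∣m⇒∣n (subst (e ∣_) (+-comm 1 (q * r)) e∣1+qr) (∣n⇒∣m*n q e∣r))
    where
    q : ℕ
    q = toℕ j * y / n
    division : toℕ j * y ≡ x * (1 + q * r)
    division = begin
      toℕ j * y                   ≡⟨ m≡m%n+[m/n]*n (toℕ j * y) n ⟩
      (toℕ j * y) % n + q * n     ≡⟨ cong (_+ q * n) (trans (sym (modN≡% _ n)) jy≡x) ⟩
      x + q * (r * x)             ≡⟨ factor x q r ⟩
      x * (1 + q * r)             ∎
      where
      open ≡-Reasoning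
      factor : ∀ x q r → x + q * (r * x) ≡ x * (1 + q * r)
      factor = solve-∀
    e∣1+qr : e ∣ 1 + q * r
    e∣1+qr = coprime-divisor (coprime-of-divisor x⊥r e∣r) (subst (e ∣_) division (∣n⇒∣m*n (toℕ j) e∣y))
  power : Coprime y r → IsPowerOf n x y
  power y⊥r with k , k<r , ky≡1 ← inverse-mod y r y⊥r = fromℕ< kx<n , (begin
    modN (toℕ (fromℕ< kx<n) * y) n  ≡⟨ cong (λ z → modN (z * y) n) (toℕ-fromℕ< kx<n) ⟩
    modN (k * x * y) n              ≡⟨ modN≡% (k * x * y) n ⟩
    (k * x * y) % n                 ≡⟨ cong (_% n) (rearrange k x y) ⟩
    (k * y * x) % n                 ≡⟨ m%n*o≡m*o%[n*o] (k * y) r x ⟨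
    ((k * y) % r) * x               ≡⟨ cong (_* x) ky≡1 ⟩
    (1 % r) * x                     ≡⟨ m%n*o≡m*o%[n*o] 1 r x ⟩
    (1 * x) % n                     ≡⟨ cong (_% n) (*-identityˡ x) ⟩
    x % n                           ≡⟨ m<n⇒m%n≡m x<n ⟩
    x                               ∎)
    where
    open ≡-Reasoning
    rearrange : ∀ k x y → k * x * y ≡ k * y * x
    rearrange = solve-∀
    kx<n : k * x < n
    kx<n = *-monoˡ-< x {{m*n≢0⇒n≢0 r}} k<r

length-filter-tabulate : ∀ {P : ℕ → Set} (P? : Decidable P) {M} N k (g : Fin N → Fin M) →
  (∀ i → toℕ (g i) ≡ k + toℕ i) → length (filter (P? ∘ toℕ) (tabulate g)) ≡ count P? k N
length-filter-tabulate P? zero    k g g≗k+ = refl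
length-filter-tabulate P? (suc N) k g g≗k+ = trans (filter-head (P? ∘ toℕ) (g Fin.zero) _)
  (cong₂ _+_ (cong (indicator ∘ P?) (trans (g≗k+ Fin.zero) (+-identityʳ k)))
             (length-filter-tabulate P? N (suc k) (g ∘ Fin.suc) λ i → trans (g≗k+ (Fin.suc i)) (+-suc k (toℕ i))))
  where
  filter-head : ∀ {A : Set} {Q : A → Set} (Q? : Decidable Q) x xs →
    length (filter Q? (x ∷ xs)) ≡ indicator (Q? x) + length (filter Q? xs)
  filter-head Q? x xs with Q? x
  ... | yes _ = refl
  ... | no  _ = refl

deg-as-count : ∀ n a → deg n a ≡ count (adj? n a) 0 n
deg-as-count n a = length-filter-tabulate (adj? n a) n 0 id (λ _ → refl)

count-divisible : ∀ d .{{_ : NonZero d}} q → count (d ∣?_) 0 (q * d) ≡ q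
count-divisible d q = begin
  count (d ∣?_) 0 (q * d)
    ≡⟨ count-cong _ _ 0 (q * d) (λ y _ _ → mk⇔ (_, tt) proj₁) ⟩
  count (λ y → (d ∣? y) ×-dec yes tt) (0 * d) (q * d)
    ≡⟨ count-multiples (λ _ → yes tt) d q 0 ⟩
  count (λ _ → yes tt) 0 q
    ≡⟨ count-all 0 q ⟩
  q ∎
  where open ≡-Reasoning

-- Membership in the closed neighbourhood of x in 𝒫(C_{r·x}) (x a unit mod r): multiples of x,
-- which are the powers of x, and units mod r, of which x is a power.
InClosedNeighbourhood : ℕ → ℕ → ℕ → Set
InClosedNeighbourhood x r y = x ∣ y ⊎ Coprime y r

inClosedNeighbourhood? : ∀ x r → Decidable (InClosedNeighbourhood x r)
inClosedNeighbourhood? x r y = (x ∣? y) ⊎-dec coprime? y r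

-- The closed neighbourhood has r + (x - 1)·φ r elements: r multiples of x plus the units
-- mod r that are not multiples of x, and among the x·φ r units, exactly φ r are multiples of x.
closed-neighbourhood-size : ∀ x r .{{_ : NonZero x}} → Coprime x r →
  count (inClosedNeighbourhood? x r) 0 (r * x) + φ r ≡ r + x * φ r
closed-neighbourhood-size x r x⊥r = begin
  count N? 0 (r * x) + φ r                     ≡⟨ cong (_+ φ r) (count-split N? (x ∣?_) 0 (r * x)) ⟩
  (count (λ y → N? y ×-dec (x ∣? y)) 0 (r * x) + count (λ y → N? y ×-dec ¬? (x ∣? y)) 0 (r * x)) + φ r
                                               ≡⟨ cong₂ (λ u v → (u + v) + φ r) multiples units ⟩
  (r + nonmultiple-units) + φ r                ≡⟨ +-assoc r _ (φ r) ⟩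
  r + (nonmultiple-units + φ r)                ≡⟨ cong (r +_) (+-comm nonmultiple-units (φ r)) ⟩
  r + (φ r + nonmultiple-units)
      ≡⟨ cong (λ u → r + (u + nonmultiple-units)) (count-coprime-multiples x r x⊥r) ⟨
  r + (count (λ y → C? y ×-dec (x ∣? y)) 0 (x * r) + nonmultiple-units)
                                               ≡⟨ cong (r +_) (count-split C? (x ∣?_) 0 (x * r)) ⟨
  r + count C? 0 (x * r)                       ≡⟨ cong (r +_) (count-periodic C? r (coprime-periodic r) x 0) ⟩
  r + x * φ r                                  ∎
  where
  open ≡-Reasoning
  N? : Decidable (InClosedNeighbourhood x r)
  N? = inClosedNeighbourhood? x r
  C? : Decidable (λ y → Coprime y r)
  C? y = coprime? y r
  nonmultiple-units : ℕ
  nonmultiple-units = count (λ y → C? y ×-dec ¬? (x ∣? y)) 0 (x * r)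
  multiples : count (λ y → N? y ×-dec (x ∣? y)) 0 (r * x) ≡ r
  multiples = trans (count-cong _ _ 0 (r * x) λ y _ _ → mk⇔ proj₂ (λ x∣y → inj₁ x∣y , x∣y))
                    (count-divisible x r)
  units : count (λ y → N? y ×-dec ¬? (x ∣? y)) 0 (r * x) ≡ nonmultiple-units
  units = trans (cong (count _ 0) (*-comm r x)) (count-cong _ _ 0 (x * r) λ y _ _ → mk⇔
    (λ { (inj₁ x∣y , x∤y) → contradiction x∣y x∤y ; (inj₂ y⊥r , x∤y) → y⊥r , x∤y })
    (λ (y⊥r , x∤y) → inj₂ y⊥r , x∤y))

adjacency : ∀ x r y .{{_ : NonZero x}} → Coprime x r → x < r * x → y < r * x →
  Adj (r * x) x y ⇔ (InClosedNeighbourhood x r y × ¬ x ≡ y)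
adjacency x r y x⊥r x<n y<n = mk⇔
  (λ (x≢y , powers) → Sum.swap (Sum.map (to unit) (to multiple) powers) , x≢y)
  (λ (closed , x≢y) → x≢y , Sum.map (from unit) (from multiple) (Sum.swap closed))
  where
  instance
    n≢0 : NonZero (r * x)
    n≢0 = >-nonZero (≤-<-trans z≤n x<n)
  unit : IsPowerOf (r * x) x y ⇔ Coprime y r
  unit = power-of-cofactor-unit x r y x⊥r x<n
  multiple : IsPowerOf (r * x) y x ⇔ x ∣ y
  multiple = power-of-divisor (r * x) x y (n∣m*n r) y<n

degree-formula : ∀ x r .{{_ : NonZero x}} → Coprime x r → x < r * x →
  deg (r * x) x + 1 + φ r ≡ r + x * φ r
degree-formula x r x⊥r x<n = begin
  deg n x + 1 + φ r                              ≡⟨ cong (λ d → d + 1 + φ r) (deg-as-count n x) ⟩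
  count (adj? n x) 0 n + 1 + φ r                 ≡⟨ cong (_+ φ r) (+-comm (count (adj? n x) 0 n) 1) ⟩
  1 + count (adj? n x) 0 n + φ r                 ≡⟨ cong₂ (λ u v → u + v + φ r) itself neighbours ⟩
  count (λ y → N? y ×-dec (x ≟ y)) 0 n + count (λ y → N? y ×-dec ¬? (x ≟ y)) 0 n + φ r
                                                 ≡⟨ cong (_+ φ r) (count-split N? (x ≟_) 0 n) ⟨
  count N? 0 n + φ r                             ≡⟨ closed-neighbourhood-size x r x⊥r ⟩
  r + x * φ r                                    ∎
  where
  open ≡-Reasoning
  n : ℕ
  n = r * x
  N? : Decidable (InClosedNeighbourhood x r)
  N? = inClosedNeighbourhood? x r
  itself : 1 ≡ count (λ y → N? y ×-dec (x ≟ y)) 0 n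
  itself = sym (trans (count-cong _ (x ≟_) 0 n λ y _ _ → mk⇔ proj₂ λ { refl → inj₁ ∣-refl , refl })
                      (count-point x 0 n z≤n x<n))
  neighbours : count (adj? n x) 0 n ≡ count (λ y → N? y ×-dec ¬? (x ≟ y)) 0 n
  neighbours = count-cong _ _ 0 n λ y _ y<n → adjacency x r y x⊥r x<n y<n

prime∣prime⇒≡ : ∀ {p q} → Prime p → Prime q → p ∣ q → p ≡ q
prime∣prime⇒≡ p-prime q-prime p∣q with prime⇒irreducible q-prime p∣q
... | inj₁ p≡1 = contradiction p≡1 (prime≢1 p-prime)
... | inj₂ p≡q = p≡q

prime-divisor : ∀ i → 1 < i → Σ ℕ λ p → Prime p × p ∣ i
prime-divisor (suc zero) (s≤s ())
prime-divisor i@(suc (suc _)) _ = first-factor (factorise i)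
  where
  first-factor : PrimeFactorisation i → Σ ℕ λ p → Prime p × p ∣ i
  first-factor record { factors = [] ; isFactorisation = () }
  first-factor record { factors = p ∷ ps ; isFactorisation = i≡pΠ ; factorsPrime = p-prime ∷ _ } =
    p , p-prime , divides (product ps) (trans i≡pΠ (*-comm p (product ps)))

SquareFree : ℕ → Set
SquareFree n = ∀ {p} → Prime p → ¬ (p * p ∣ n)

distinct-primes-squarefree : ∀ {ps} → All Prime ps → Unique ps → SquareFree (product ps)
distinct-primes-squarefree {[]} [] [] {p} p-prime pp∣1 = prime≢1 p-prime (m*n≡1⇒n≡1 p p (∣1⇒≡1 pp∣1))
distinct-primes-squarefree {q ∷ qs} (q-prime ∷ qs-prime) (q∉qs ∷ qs-distinct) {p} p-prime pp∣qΠ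
  with p ≟ q
... | yes refl = All.lookup q∉qs p∈qs refl
  where
  instance
    p≢0 : NonZero p
    p≢0 = prime⇒nonZero p-prime
  p∈qs : p ∈ qs
  p∈qs = factorisationHasAllPrimeFactors p-prime (*-cancelˡ-∣ {p} p pp∣qΠ) qs-prime
... | no  p≢q = distinct-primes-squarefree qs-prime qs-distinct p-prime (coprime-divisor pp⊥q pp∣qΠ)
  where
  -- q is prime and does not divide p·p
  pp⊥q : Coprime (p * p) q
  pp⊥q {e} (e∣pp , e∣q) with prime⇒irreducible q-prime e∣q
  ... | inj₁ e≡1 = e≡1
  ... | inj₂ refl = contradiction (prime∣prime⇒≡ q-prime p-prime q∣p) (p≢q ∘ sym)
    where
    q∣p : q ∣ p
    q∣p = Sum.[ id , id ]′ (euclidsLemma p p q-prime e∣pp)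

squarefree⇒coprime : ∀ {n x y} .{{_ : NonZero n}} → SquareFree n → x * y ∣ n → Coprime x y
squarefree⇒coprime {n} {x} {y} sf xy∣n {zero} (0∣x , _) =
  contradiction (0∣⇒≡0 (subst (_∣ n) (cong (_* y) (0∣⇒≡0 0∣x)) xy∣n)) (≢-nonZero⁻¹ n)
squarefree⇒coprime sf xy∣n {suc zero} _ = refl
squarefree⇒coprime sf xy∣n {i@(suc (suc _))} (i∣x , i∣y)
  with p , p-prime , p∣i ← prime-divisor i (s≤s (s≤s z≤n)) =
  contradiction (∣-trans (*-pres-∣ (∣-trans p∣i i∣x) (∣-trans p∣i i∣y)) xy∣n) (sf p-prime)

degree-formula-squarefree : ∀ {n} x r .{{_ : NonZero n}} → SquareFree n → n ≡ r * x → 1 < r →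
  deg n x + 1 + φ r ≡ r + x * φ r
degree-formula-squarefree {n} x r sf n≡rx 1<r =
  subst (λ n → deg n x + 1 + φ r ≡ r + x * φ r) (sym n≡rx) (degree-formula x r x⊥r x<rx)
  where
  instance
    x≢0 : NonZero x
    x≢0 = m*n≢0⇒n≢0 r {{≢-nonZero λ rx≡0 → ≢-nonZero⁻¹ n (trans n≡rx rx≡0)}}
  x⊥r : Coprime x r
  x⊥r = squarefree⇒coprime sf (divides 1 (trans n≡rx (trans (*-comm r x) (sym (*-identityˡ (x * r))))))
  x<rx : x < r * x
  x<rx = subst (x <_) (*-comm x r) (m<m*n x r 1<r)

ratio-primes-distinct : ∀ {a b p q} .{{_ : NonZero q}} → a ≢ b → a * q ≡ b * p → p ≢ q
ratio-primes-distinct {a} {b} {p} a≢b aq≡bq refl = a≢b (*-cancelʳ-≡ a b p aq≡bq)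

common-cofactor : ∀ a b {p q} → Prime p → Prime q → p ≢ q → a * q ≡ b * p →
  Σ ℕ λ m → a ≡ m * p × b ≡ m * q
common-cofactor a b {p} {q} p-prime q-prime p≢q aq≡bp
  with euclidsLemma b p q-prime (subst (q ∣_) aq≡bp (n∣m*n a))
... | inj₂ q∣p = contradiction (prime∣prime⇒≡ q-prime p-prime q∣p) (p≢q ∘ sym)
... | inj₁ (divides m refl) = m , *-cancelʳ-≡ a (m * p) q {{prime⇒nonZero q-prime}} (begin
  a * q        ≡⟨ aq≡bp ⟩
  m * q * p    ≡⟨ swap-factors m q p ⟩
  m * p * q    ∎) , refl
  where
  open ≡-Reasoning
  swap-factors : ∀ m q p → m * q * p ≡ m * p * q
  swap-factors = solve-∀

cofactor-decomposition : ∀ {n} m {p q} → SquareFree n → Prime p → Prime q → p ≢ q →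
  m * p ∣ n → m * q ∣ n → Σ ℕ λ s → n ≡ s * p * (m * q)
cofactor-decomposition {n} m {p} {q} sf p-prime q-prime p≢q mp∣n (divides c n≡c*mq)
  with euclidsLemma c (m * q) p-prime (subst (p ∣_) n≡c*mq (∣-trans (n∣m*n m) mp∣n))
... | inj₁ (divides s refl) = s , n≡c*mq
... | inj₂ p∣mq with euclidsLemma m q p-prime p∣mq
...   | inj₁ p∣m = contradiction (∣-trans (*-pres-∣ p∣m (∣-refl {p})) mp∣n) (sf p-prime)
...   | inj₂ p∣q = contradiction (prime∣prime⇒≡ p-prime q-prime p∣q) p≢q

-- Let q = p + d, F = φ s, K = φ (p·s) with K + F = p·F, so that
-- φ (q·s) = K + d·F.  Then the degree formulas for m·p and m·q (with cofactors q·s and p·s)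
-- force deg (m·p) - deg (m·q) = d·(s + (m - 1)·F).
degree-difference : ∀ p d m s F Da Db K → K + F ≡ p * F →
  Da + 1 + (K + d * F) ≡ (p + d) * s + (m * p) * (K + d * F) →
  Db + 1 + K ≡ p * s + (m * (p + d)) * K →
  Da + d * F ≡ Db + d * (s + m * F)
degree-difference p d m s F Da Db K K+F≡pF Da-formula Db-formula =
  +-cancelʳ-≡ (1 + (K + d * F) + m * d * K) _ _ (begin
    (Da + d * F) + (1 + (K + d * F) + m * d * K)
      ≡⟨ regroupᴬ Da d F K m ⟩
    (Da + 1 + (K + d * F)) + (d * F + m * d * K)
      ≡⟨ cong (_+ (d * F + m * d * K)) Da-formula ⟩
    ((p + d) * s + (m * p) * (K + d * F)) + (d * F + m * d * K)
      ≡⟨ expand p d m s F K ⟩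
    p * s + m * (p + d) * K + d * s + m * d * (p * F) + d * F
      ≡⟨ cong (λ z → p * s + m * (p + d) * K + d * s + m * d * z + d * F) K+F≡pF ⟨
    p * s + m * (p + d) * K + d * s + m * d * (K + F) + d * F
      ≡⟨ collect p d m s F K ⟩
    (p * s + m * (p + d) * K) + (d * (s + m * F) + d * F + m * d * K)
      ≡⟨ cong (_+ (d * (s + m * F) + d * F + m * d * K)) Db-formula ⟨
    (Db + 1 + K) + (d * (s + m * F) + d * F + m * d * K)
      ≡⟨ regroupᴮ Db d s m F K ⟩
    (Db + d * (s + m * F)) + (1 + (K + d * F) + m * d * K) ∎)
  where
  open ≡-Reasoning
  regroupᴬ : ∀ Da d F K m →
    (Da + d * F) + (1 + (K + d * F) + m * d * K) ≡ (Da + 1 + (K + d * F)) + (d * F + m * d * K)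
  regroupᴬ = solve-∀
  expand : ∀ p d m s F K →
    ((p + d) * s + (m * p) * (K + d * F)) + (d * F + m * d * K)
      ≡ p * s + m * (p + d) * K + d * s + m * d * (p * F) + d * F
  expand = solve-∀
  collect : ∀ p d m s F K →
    p * s + m * (p + d) * K + d * s + m * d * (K + F) + d * F
      ≡ (p * s + m * (p + d) * K) + (d * (s + m * F) + d * F + m * d * K)
  collect = solve-∀
  regroupᴮ : ∀ Db d s m F K →
    (Db + 1 + K) + (d * (s + m * F) + d * F + m * d * K)
      ≡ (Db + d * (s + m * F)) + (1 + (K + d * F) + m * d * K)
  regroupᴮ = solve-∀

positive-gap : ∀ d s m F → 0 < d → 0 < s → 0 < m → d * F < d * (s + m * F)
positive-gap d s m F 0<d 0<s 0<m = *-monoʳ-< d {{>-nonZero 0<d}}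
  (≤-<-trans (m≤n*m F m {{>-nonZero 0<m}}) (m<n+m (m * F) 0<s))

degree-comparison : ∀ {n} m s {p q} .{{_ : NonZero n}} → SquareFree n → Prime p → Prime q → p < q →
  n ≡ s * p * (m * q) → deg n (m * q) < deg n (m * p)
degree-comparison {n} m s {p} {q} sf p-prime q-prime p<q n≡spmq
  with d , refl ← m≤n⇒∃[o]m+o≡n (<⇒≤ p<q) =
  +-cancelʳ-< (d * φ s) (deg n (m * q)) (deg n (m * p)) (begin-strict
    deg n (m * q) + d * φ s             <⟨ +-monoʳ-< (deg n (m * q)) (positive-gap d s m (φ s) 0<d 0<s 0<m) ⟩
    deg n (m * q) + d * (s + m * φ s)
      ≡⟨ degree-difference p d m s (φ s) _ _ (φ (p * s)) φ[ps] Da-formula Db-formula ⟨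
    deg n (m * p) + d * φ s             ∎)
  where
  open ≤-Reasoning
  instance
    n′≢0 : NonZero (s * p * (m * q))
    n′≢0 = ≢-nonZero λ n′≡0 → ≢-nonZero⁻¹ n (trans n≡spmq n′≡0)
  0<s : 0 < s
  0<s = >-nonZero⁻¹ s {{m*n≢0⇒m≢0 s {{m*n≢0⇒m≢0 (s * p)}}}}
  0<m : 0 < m
  0<m = >-nonZero⁻¹ m {{m*n≢0⇒m≢0 m {{m*n≢0⇒n≢0 (s * p)}}}}
  0<d : 0 < d
  0<d = +-cancelˡ-< p 0 d (subst (_< q) (sym (+-identityʳ p)) p<q)
  n≡qs·mp : n ≡ q * s * (m * p)
  n≡qs·mp = trans n≡spmq (rearrange s p m q)
    where
    rearrange : ∀ s p m q → s * p * (m * q) ≡ q * s * (m * p)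
    rearrange = solve-∀
  n≡ps·mq : n ≡ p * s * (m * q)
  n≡ps·mq = trans n≡spmq (cong (_* (m * q)) (*-comm s p))
  1<r·s : ∀ {r} → Prime r → 1 < r * s
  1<r·s {r} r-prime =
    <-≤-trans (nonTrivial⇒n>1 r {{prime⇒nonTrivial r-prime}}) (m≤m*n r s {{>-nonZero 0<s}})
  coprime-to-s : ∀ {r} x → n ≡ r * s * x → Coprime r s
  coprime-to-s {r} x n≡rsx = squarefree⇒coprime sf (divides x (trans n≡rsx (*-comm (r * s) x)))
  φ[ps] : φ (p * s) + φ s ≡ p * φ s
  φ[ps] = φ-prime-* p s p-prime (coprime-to-s (m * q) n≡ps·mq)
  Da-formula : deg n (m * p) + 1 + (φ (p * s) + d * φ s) ≡ q * s + (m * p) * (φ (p * s) + d * φ s)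
  Da-formula = subst (λ z → deg n (m * p) + 1 + z ≡ q * s + (m * p) * z)
    (φ-prime-*-difference p d s p-prime q-prime (coprime-to-s (m * q) n≡ps·mq) (coprime-to-s (m * p) n≡qs·mp))
    (degree-formula-squarefree (m * p) (q * s) sf n≡qs·mp (1<r·s q-prime))
  Db-formula : deg n (m * q) + 1 + φ (p * s) ≡ p * s + (m * q) * φ (p * s)
  Db-formula = degree-formula-squarefree (m * q) (p * s) sf n≡ps·mq (1<r·s p-prime)

-- The theorem for an arbitrary squarefree n: if a, b ∣ n are distinct with a/b = p/q for
-- primes p, q and a < b, then deg b < deg a in 𝒫(C_n).  (Properness of a and b is automatic.)
squarefree-degree-comparison : ∀ {n a b p q} .{{_ : NonZero n}} → SquareFree n → Prime p → Prime q →
  a ∣ n → b ∣ n → a ≢ b → a * q ≡ b * p → a < b → deg n b < deg n a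
squarefree-degree-comparison {a = a} {b} {p} {q} sf p-prime q-prime a∣n b∣n a≢b aq≡bp a<b
  with p≢q ← ratio-primes-distinct {{prime⇒nonZero q-prime}} a≢b aq≡bp
  with m , refl , refl ← common-cofactor a b p-prime q-prime p≢q aq≡bp
  with s , n≡spmq ← cofactor-decomposition m sf p-prime q-prime p≢q a∣n b∣n
  = degree-comparison m s sf p-prime q-prime (*-cancelˡ-< m p q a<b) n≡spmq

lemma2p4 : (ps : List ℕ) → All Prime ps → Unique ps →
    (n a b : ℕ) → n ≡ product ps →
    a ∣ n → a ≢ 1 → a ≢ n →
    b ∣ n → b ≢ 1 → b ≢ n →
    a ≢ b →
    Σ ℕ (λ pk → Σ ℕ (λ pl → pk ∈ ps × pl ∈ ps × a * pl ≡ b * pk)) →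
    a < b → deg n b < deg n a
lemma2p4 ps ps-prime ps-distinct n a b refl a∣n _ _ b∣n _ _ a≢b (pk , pl , pk∈ps , pl∈ps , a·pl≡b·pk) a<b =
  squarefree-degree-comparison {{productOfPrimes≢0 ps-prime}}
    (distinct-primes-squarefree ps-prime ps-distinct) (All.lookup ps-prime pk∈ps) (All.lookup ps-prime pl∈ps)
    a∣n b∣n a≢b a·pl≡b·pk a<b
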